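{- Let $a,b$ be positive integers with $1\le a<b$, let $G$ be a finite simple graph and let $e=uv\in E(G)$. Put $G'=G-e$. For $S\subseteq V(G)$ let $T=\{x\in V(G)-S: d_{G-S}(x)\le a-1\}$, $\delta_G(a,b;S)=b|S|-a|T|+d_{G-S}(T)$, $T'=\{x\in V(G)-S: d_{G'-S}(x)\leq a-1\}$, and $$\rho(S)=\begin{cases}2 & \text{if both } u,v\in T',\\ 1 & \text{if one of } u,v \text{ lies in } T' \text{ and the other lies in } V(G)-(S\cup T'),\\ 0&\text{otherwise.}\end{cases}$$ Then $G$ has an $[a,b]$-factor not containing the edge $e$ (equivalently, $G-e$ has an $[a,b]$-factor) if and only if $\delta_G(a,b;S)\geq \rho(S)$ for every $S\subseteq V(G)$.
   Context: A spanning subgraph $H$ of $G$ is an $[a,b]$-factor if $a\le d_H(x)\le b$ for every $x\in V(G)$. For a vertex set $T$ of a graph $F$, $d_F(T)=\sum_{x\in T}d_F(x)$. -}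

module Defs where

open import Data.Nat using (ℕ; zero; suc; _+_; _*_; _∸_; _≤_; _≤ᵇ_)
open import Data.Bool using (Bool; true; false; _∧_; _∨_; not; if_then_else_)
open import Data.Fin using (Fin; _≟_)
open import Data.List using (List; length; filterᵇ; map; allFin)
open import Data.Nat.ListAction using (sum)
open import Data.Integer as ℤ using (ℤ; +_)
open import Data.Product using (_×_; Σ)
open import Relation.Nullary.Decidable using (⌊_⌋)
open import Relation.Binary.PropositionalEquality using (_≡_)

BRel : ℕ → Set
BRel n = Fin n → Fin n → Bool

VSet : ℕ → Set
VSet n = Fin n → Bool

IsSimple : ∀ {n} → BRel n → Set
IsSimple {n} G = (∀ (x y : Fin n) → G x y ≡ G y x) × (∀ (x : Fin n) → G x x ≡ false)

countV : ∀ {n} → (Fin n → Bool) → ℕ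
countV {n} P = length (filterᵇ P (allFin n))

card : ∀ {n} → VSet n → ℕ
card S = countV S

sumOver : ∀ {n} → VSet n → (Fin n → ℕ) → ℕ
sumOver {n} T f = sum (map f (filterᵇ T (allFin n)))

deg : ∀ {n} → BRel n → Fin n → ℕ
deg G x = countV (λ y → G x y)

-- degree of x in G - S (meaningful for x ∉ S)
degMinus : ∀ {n} → BRel n → VSet n → Fin n → ℕ
degMinus G S x = countV (λ y → not (S y) ∧ G x y)

deleteEdge : ∀ {n} → BRel n → Fin n → Fin n → BRel n
deleteEdge G u v x y =
  G x y ∧ not ((⌊ x ≟ u ⌋ ∧ ⌊ y ≟ v ⌋) ∨ (⌊ x ≟ v ⌋ ∧ ⌊ y ≟ u ⌋))

IsSpanningSubgraph : ∀ {n} → BRel n → BRel n → Set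
IsSpanningSubgraph {n} H G =
  IsSimple H × (∀ (x y : Fin n) → H x y ≡ true → G x y ≡ true)

IsFactor : ∀ {n} → ℕ → ℕ → BRel n → BRel n → Set
IsFactor {n} a b G H =
  IsSpanningSubgraph H G × (∀ (x : Fin n) → a ≤ deg H x × deg H x ≤ b)

HasFactor : ∀ {n} → ℕ → ℕ → BRel n → Set
HasFactor a b G = Σ (BRel _) (λ H → IsFactor a b G H)

Tset : ∀ {n} → ℕ → BRel n → VSet n → VSet n
Tset a G S x = not (S x) ∧ (degMinus G S x ≤ᵇ a ∸ 1)

delta : ∀ {n} → ℕ → ℕ → BRel n → VSet n → ℤ
delta a b G S =
  (+ (b * card S) ℤ.- + (a * card (Tset a G S))) ℤ.+ + sumOver (Tset a G S) (degMinus G S)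

rho : ∀ {n} → ℕ → BRel n → Fin n → Fin n → VSet n → ℕ
rho a G u v S =
  let T' = Tset a (deleteEdge G u v) S
      rest : VSet _
      rest x = not (S x ∨ T' x)
  in if T' u ∧ T' v then 2
     else if (T' u ∧ rest v) ∨ (T' v ∧ rest u) then 1
     else 0

-- Deleting uv lowers δ by exactly ρ, because only u and v lose a neighbour outside S.
-- So the theorem is Lovász's criterion for a < b applied to G - uv: an [a,b]-factor
-- exists iff δ(S) ≥ 0 for every S.  Necessity is double counting of factor edges at T.
-- For sufficiency, start from the empty graph and repeatedly lower the deficiency
-- Σ (a ∸ d_H) of a spanning subgraph H with degrees ≤ b: from a vertex x0 with
-- d_H(x0) < a grow alternating paths (an edge outside H, an edge of H, ...) through
-- vertices that cannot absorb the change.  Toggling the edges of such a path improves H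
-- as soon as it reaches a vertex with room for the change, or returns to one of its own
-- vertices with the same parity; in the latter case a < b provides the room.  If no path
-- can be extended, the even vertices E and odd vertices O satisfy b|O| + d_{G-O}(E) < a|E|,
-- while T(O) maximises a|X| - d_{G-O}(X) over the X disjoint from O; so δ(O) < 0.

module Submission where

open import Data.Bool using (Bool; true; false; _∧_; _∨_; not; _xor_; if_then_else_)
import Data.Bool.Properties as Boolₚ
open import Data.Empty using (⊥; ⊥-elim)
open import Data.Fin using (Fin; zero; suc; _≟_)
import Data.Fin.Properties as Finₚ
open import Data.Integer as ℤ using (ℤ)
import Data.Integer.Properties as ℤₚ
import Data.Integer.Solver as ℤ-Solver
open import Data.List using (List; []; _∷_; length; filterᵇ; map; allFin; tabulate)
open import Data.List.Membership.Propositional using (_∈_; _∉_)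
open import Data.List.Properties using (map-tabulate)
open import Data.List.Relation.Unary.Any using (here; there)
open import Data.Nat using (ℕ; zero; suc; _+_; _*_; _∸_; _≤_; _<_; _≤ᵇ_; _≤?_; _<?_; z≤n; s≤s)
open import Data.Nat.Induction using (<-wellFounded)
open import Data.Nat.ListAction using () renaming (sum to listSum)
open import Data.Nat.Properties hiding (_≟_)
import Data.Nat.Solver as ℕ-Solver
open import Data.Product using (_×_; _,_; proj₁; proj₂; Σ; ∃; ∃₂)
open import Data.Sum using (_⊎_; inj₁; inj₂)
open import Function using (_∘_; _⇔_; mk⇔; Equivalence)
open import Induction.WellFounded using (Acc; acc)
open import Relation.Binary.PropositionalEquality
open import Relation.Nullary using (¬_; Dec; yes; no; ofʸ; ofⁿ)
open import Relation.Nullary.Decidable using (⌊_⌋; _×-dec_)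

open import Algebra.Properties.CommutativeMonoid.Sum +-0-commutativeMonoid
  using (sum-syntax; sum-cong-≗; sum-replicate-zero; ∑-distrib-+; ∑-comm)
open import Algebra.Properties.CommutativeSemigroup +-commutativeSemigroup using (xy∙z≈xz∙y)
open import Algebra.Properties.Semiring.Sum +-*-semiring using (*-distribˡ-sum)

open import Defs

𝟙 : Bool → ℕ
𝟙 true = 1
𝟙 false = 0

listSum-tabulate : ∀ {n} (f : Fin n → ℕ) → listSum (tabulate f) ≡ ∑[ i < n ] f i
listSum-tabulate {zero} f = refl
listSum-tabulate {suc n} f = cong (f zero +_) (listSum-tabulate (f ∘ suc))

listSum-allFin : ∀ {n} (f : Fin n → ℕ) → listSum (map f (allFin n)) ≡ ∑[ i < n ] f i
listSum-allFin f = trans (cong listSum (map-tabulate (λ i → i) f)) (listSum-tabulate f)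

length-filterᵇ : ∀ {A : Set} (P : A → Bool) (xs : List A) →
  length (filterᵇ P xs) ≡ listSum (map (𝟙 ∘ P) xs)
length-filterᵇ P [] = refl
length-filterᵇ P (x ∷ xs) with P x
... | true = cong suc (length-filterᵇ P xs)
... | false = length-filterᵇ P xs

listSum-filterᵇ : ∀ {A : Set} (P : A → Bool) (f : A → ℕ) (xs : List A) →
  listSum (map f (filterᵇ P xs)) ≡ listSum (map (λ x → 𝟙 (P x) * f x) xs)
listSum-filterᵇ P f [] = refl
listSum-filterᵇ P f (x ∷ xs) with P x
... | true = cong₂ _+_ (sym (+-identityʳ (f x))) (listSum-filterᵇ P f xs)
... | false = listSum-filterᵇ P f xs

countV≡∑ : ∀ {n} (P : Fin n → Bool) → countV P ≡ ∑[ x < n ] 𝟙 (P x)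
countV≡∑ {n} P = trans (length-filterᵇ P (allFin n)) (listSum-allFin (𝟙 ∘ P))

sumOver≡∑ : ∀ {n} (T : VSet n) (f : Fin n → ℕ) → sumOver T f ≡ ∑[ x < n ] (𝟙 (T x) * f x)
sumOver≡∑ {n} T f = trans (listSum-filterᵇ T f (allFin n)) (listSum-allFin {n} _)

*-card : ∀ {n} c (T : VSet n) → c * card T ≡ ∑[ x < n ] (c * 𝟙 (T x))
*-card c T = trans (cong (c *_) (countV≡∑ T)) (*-distribˡ-sum c (𝟙 ∘ T))

𝟙-∧ : ∀ p q → 𝟙 (p ∧ q) ≡ 𝟙 p * 𝟙 q
𝟙-∧ true q = sym (+-identityʳ (𝟙 q))
𝟙-∧ false q = refl

𝟙≤1 : ∀ p → 𝟙 p ≤ 1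
𝟙≤1 true = ≤-refl
𝟙≤1 false = z≤n

∧-mapʳ : ∀ {p q r} → (q ≡ true → r ≡ true) → p ∧ q ≡ true → p ∧ r ≡ true
∧-mapʳ {true} q⇒r = q⇒r

sum-bool-< : ∀ {f g : Bool → ℕ} p → (∀ r → f r ≤ g r) → f p < g p → f false + f true < g false + g true
sum-bool-< false f≤g fp<gp = +-mono-<-≤ fp<gp (f≤g true)
sum-bool-< true f≤g fp<gp = +-mono-≤-< (f≤g false) fp<gp

countV-cong : ∀ {n} {P Q : Fin n → Bool} → (∀ x → P x ≡ Q x) → countV P ≡ countV Q
countV-cong {P = P} {Q} P≗Q =
  trans (countV≡∑ P) (trans (sum-cong-≗ (cong 𝟙 ∘ P≗Q)) (sym (countV≡∑ Q)))

∑-mono-≤ : ∀ {n} {f g : Fin n → ℕ} → (∀ i → f i ≤ g i) → ∑[ i < n ] f i ≤ ∑[ i < n ] g i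
∑-mono-≤ {zero} f≤g = z≤n
∑-mono-≤ {suc n} f≤g = +-mono-≤ (f≤g zero) (∑-mono-≤ (f≤g ∘ suc))

∑-mono-< : ∀ {n} {f g : Fin n → ℕ} (j : Fin n) →
  (∀ i → f i ≤ g i) → f j < g j → ∑[ i < n ] f i < ∑[ i < n ] g i
∑-mono-< zero f≤g fj<gj = +-mono-<-≤ fj<gj (∑-mono-≤ (f≤g ∘ suc))
∑-mono-< (suc j) f≤g fj<gj = +-mono-≤-< (f≤g zero) (∑-mono-< j (f≤g ∘ suc) fj<gj)

∑-pick : ∀ {n} (j : Fin n) (f : Fin n → ℕ) → ∑[ i < n ] (𝟙 ⌊ i ≟ j ⌋ * f i) ≡ f j
∑-pick {suc n} zero f = begin
  f zero + 0 + ∑[ i < n ] 0 ≡⟨ cong (f zero + 0 +_) (sum-replicate-zero n) ⟩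
  f zero + 0 + 0            ≡⟨ trans (+-identityʳ _) (+-identityʳ _) ⟩
  f zero                    ∎
  where open ≡-Reasoning
∑-pick {suc n} (suc j) f =
  trans (sum-cong-≗ λ i → cong (λ b → 𝟙 b * f (suc i)) (≟-suc i j)) (∑-pick j (f ∘ suc))
  where
  ≟-suc : ∀ {m} (i j : Fin m) → ⌊ suc i ≟ suc j ⌋ ≡ ⌊ i ≟ j ⌋
  ≟-suc i j with i ≟ j
  ... | yes _ = refl
  ... | no _ = refl

countV-update : ∀ {n} {P Q : Fin n → Bool} (w : Fin n) → (∀ y → y ≢ w → P y ≡ Q y) →
  countV P + 𝟙 (Q w) ≡ countV Q + 𝟙 (P w)
countV-update {n} {P} {Q} w P≡Q = begin
  countV P + 𝟙 (Q w)
    ≡⟨ cong₂ _+_ (countV≡∑ P) (sym (∑-pick w (λ _ → 𝟙 (Q w)))) ⟩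
  ∑[ y < n ] 𝟙 (P y) + ∑[ y < n ] (𝟙 ⌊ y ≟ w ⌋ * 𝟙 (Q w))
    ≡⟨ ∑-distrib-+ (𝟙 ∘ P) (λ y → 𝟙 ⌊ y ≟ w ⌋ * 𝟙 (Q w)) ⟨
  ∑[ y < n ] (𝟙 (P y) + 𝟙 ⌊ y ≟ w ⌋ * 𝟙 (Q w))
    ≡⟨ sum-cong-≗ exchange ⟩
  ∑[ y < n ] (𝟙 (Q y) + 𝟙 ⌊ y ≟ w ⌋ * 𝟙 (P w))
    ≡⟨ ∑-distrib-+ (𝟙 ∘ Q) (λ y → 𝟙 ⌊ y ≟ w ⌋ * 𝟙 (P w)) ⟩
  ∑[ y < n ] 𝟙 (Q y) + ∑[ y < n ] (𝟙 ⌊ y ≟ w ⌋ * 𝟙 (P w))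
    ≡⟨ cong₂ _+_ (sym (countV≡∑ Q)) (∑-pick w (λ _ → 𝟙 (P w))) ⟩
  countV Q + 𝟙 (P w) ∎
  where
  open ≡-Reasoning
  exchange : ∀ y → 𝟙 (P y) + 𝟙 ⌊ y ≟ w ⌋ * 𝟙 (Q w) ≡ 𝟙 (Q y) + 𝟙 ⌊ y ≟ w ⌋ * 𝟙 (P w)
  exchange y with y ≟ w
  ... | yes refl = begin
    𝟙 (P y) + 1 * 𝟙 (Q y) ≡⟨ cong (𝟙 (P y) +_) (*-identityˡ _) ⟩
    𝟙 (P y) + 𝟙 (Q y)     ≡⟨ +-comm (𝟙 (P y)) _ ⟩
    𝟙 (Q y) + 𝟙 (P y)     ≡⟨ cong (𝟙 (Q y) +_) (*-identityˡ _) ⟨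
    𝟙 (Q y) + 1 * 𝟙 (P y) ∎
  ... | no y≢w = cong (λ b → 𝟙 b + 0) (P≡Q y y≢w)

module _ {n : ℕ} where

  𝟙-split : ∀ q p → 𝟙 p ≡ 𝟙 (q ∧ p) + 𝟙 (not q ∧ p)
  𝟙-split true p = sym (+-identityʳ (𝟙 p))
  𝟙-split false p = refl

  countV-split : ∀ (Q P : Fin n → Bool) →
    countV P ≡ countV (λ y → Q y ∧ P y) + countV (λ y → not (Q y) ∧ P y)
  countV-split Q P = begin
    countV P                                         ≡⟨ countV≡∑ P ⟩
    ∑[ y < n ] 𝟙 (P y)                               ≡⟨ sum-cong-≗ (λ y → 𝟙-split (Q y) (P y)) ⟩
    ∑[ y < n ] (𝟙 (Q y ∧ P y) + 𝟙 (not (Q y) ∧ P y)) ≡⟨ ∑-distrib-+ (λ y → 𝟙 (Q y ∧ P y)) _ ⟩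
    ∑[ y < n ] 𝟙 (Q y ∧ P y) + ∑[ y < n ] 𝟙 (not (Q y) ∧ P y)
      ≡⟨ cong₂ _+_ (countV≡∑ (λ y → Q y ∧ P y)) (countV≡∑ (λ y → not (Q y) ∧ P y)) ⟨
    countV (λ y → Q y ∧ P y) + countV (λ y → not (Q y) ∧ P y) ∎
    where open ≡-Reasoning

  countV-mono : ∀ {P Q : Fin n → Bool} → (∀ y → P y ≡ true → Q y ≡ true) → countV P ≤ countV Q
  countV-mono {P} {Q} P⇒Q = begin
    countV P             ≡⟨ countV≡∑ P ⟩
    ∑[ y < n ] 𝟙 (P y)   ≤⟨ ∑-mono-≤ 𝟙-mono ⟩
    ∑[ y < n ] 𝟙 (Q y)   ≡⟨ countV≡∑ Q ⟨
    countV Q             ∎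
    where
    open ≤-Reasoning
    𝟙-mono : ∀ y → 𝟙 (P y) ≤ 𝟙 (Q y)
    𝟙-mono y with P y in Py
    ... | true rewrite P⇒Q y Py = ≤-refl
    ... | false = z≤n

  private
    weighted-mono : ∀ {X : VSet n} {f g : Fin n → ℕ} → (∀ x → X x ≡ true → f x ≤ g x) →
      ∀ x → 𝟙 (X x) * f x ≤ 𝟙 (X x) * g x
    weighted-mono {X} f≤g x with X x in Xx
    ... | true = +-monoˡ-≤ 0 (f≤g x Xx)
    ... | false = z≤n

  sumOver-mono : ∀ {X : VSet n} {f g : Fin n → ℕ} → (∀ x → X x ≡ true → f x ≤ g x) →
    sumOver X f ≤ sumOver X g
  sumOver-mono {X} {f} {g} f≤g = begin
    sumOver X f                 ≡⟨ sumOver≡∑ X f ⟩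
    ∑[ x < n ] (𝟙 (X x) * f x)  ≤⟨ ∑-mono-≤ (weighted-mono f≤g) ⟩
    ∑[ x < n ] (𝟙 (X x) * g x)  ≡⟨ sumOver≡∑ X g ⟨
    sumOver X g                 ∎
    where open ≤-Reasoning

  sumOver-mono-< : ∀ {X : VSet n} {f g : Fin n → ℕ} (j : Fin n) →
    (∀ x → X x ≡ true → f x ≤ g x) → X j ≡ true → f j < g j → sumOver X f < sumOver X g
  sumOver-mono-< {X} {f} {g} j f≤g Xj fj<gj = begin-strict
    sumOver X f                 ≡⟨ sumOver≡∑ X f ⟩
    ∑[ x < n ] (𝟙 (X x) * f x)  <⟨ ∑-mono-< j (weighted-mono f≤g) at-j ⟩
    ∑[ x < n ] (𝟙 (X x) * g x)  ≡⟨ sumOver≡∑ X g ⟨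
    sumOver X g                 ∎
    where
    open ≤-Reasoning
    at-j : 𝟙 (X j) * f j < 𝟙 (X j) * g j
    at-j rewrite Xj = +-monoˡ-< 0 fj<gj

  sumOver-cong : ∀ {X : VSet n} {f g : Fin n → ℕ} → (∀ x → X x ≡ true → f x ≡ g x) →
    sumOver X f ≡ sumOver X g
  sumOver-cong f≡g = ≤-antisym (sumOver-mono (λ x Xx → ≤-reflexive (f≡g x Xx)))
                               (sumOver-mono (λ x Xx → ≤-reflexive (sym (f≡g x Xx))))

  sumOver-+ : ∀ (X : VSet n) (f g : Fin n → ℕ) →
    sumOver X (λ x → f x + g x) ≡ sumOver X f + sumOver X g
  sumOver-+ X f g = begin
    sumOver X (λ x → f x + g x)               ≡⟨ sumOver≡∑ X _ ⟩
    ∑[ x < n ] (𝟙 (X x) * (f x + g x))        ≡⟨ sum-cong-≗ (λ x → *-distribˡ-+ (𝟙 (X x)) (f x) (g x)) ⟩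
    ∑[ x < n ] (𝟙 (X x) * f x + 𝟙 (X x) * g x) ≡⟨ ∑-distrib-+ (λ x → 𝟙 (X x) * f x) _ ⟩
    ∑[ x < n ] (𝟙 (X x) * f x) + ∑[ x < n ] (𝟙 (X x) * g x) ≡⟨ cong₂ _+_ (sumOver≡∑ X f) (sumOver≡∑ X g) ⟨
    sumOver X f + sumOver X g                 ∎
    where open ≡-Reasoning

  sumOver-const : ∀ (X : VSet n) c → sumOver X (λ _ → c) ≡ c * card X
  sumOver-const X c = trans (sumOver≡∑ X (λ _ → c))
    (trans (sum-cong-≗ (λ x → *-comm (𝟙 (X x)) c)) (sym (*-card c X)))

  sumOver-countV : ∀ (X : VSet n) (R : BRel n) →
    sumOver X (λ x → countV (R x)) ≡ ∑[ x < n ] ∑[ y < n ] (𝟙 (X x) * 𝟙 (R x y))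
  sumOver-countV X R = trans (sumOver≡∑ X _) (sum-cong-≗ λ x →
    trans (cong (𝟙 (X x) *_) (countV≡∑ (R x))) (*-distribˡ-sum (𝟙 (X x)) (𝟙 ∘ R x)))

  double-count : ∀ {H : BRel n} → (∀ x y → H x y ≡ H y x) → ∀ (X Y : VSet n) →
    sumOver X (λ x → countV (λ y → Y y ∧ H x y)) ≡ sumOver Y (λ y → countV (λ x → X x ∧ H y x))
  double-count {H} Hsym X Y = begin
    sumOver X (λ x → countV (λ y → Y y ∧ H x y))
      ≡⟨ sumOver-countV X (λ x y → Y y ∧ H x y) ⟩
    ∑[ x < n ] ∑[ y < n ] (𝟙 (X x) * 𝟙 (Y y ∧ H x y))
      ≡⟨ ∑-comm (λ x y → 𝟙 (X x) * 𝟙 (Y y ∧ H x y)) ⟩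
    ∑[ y < n ] ∑[ x < n ] (𝟙 (X x) * 𝟙 (Y y ∧ H x y))
      ≡⟨ sum-cong-≗ (λ y → sum-cong-≗ (λ x → exchange x y)) ⟩
    ∑[ y < n ] ∑[ x < n ] (𝟙 (Y y) * 𝟙 (X x ∧ H y x))
      ≡⟨ sumOver-countV Y (λ y x → X x ∧ H y x) ⟨
    sumOver Y (λ y → countV (λ x → X x ∧ H y x)) ∎
    where
    open ≡-Reasoning
    open ℕ-Solver.+-*-Solver
    exchange : ∀ x y → 𝟙 (X x) * 𝟙 (Y y ∧ H x y) ≡ 𝟙 (Y y) * 𝟙 (X x ∧ H y x)
    exchange x y rewrite 𝟙-∧ (Y y) (H x y) | 𝟙-∧ (X x) (H y x) | Hsym x y =
      solve 3 (λ p q r → p :* (q :* r) := q :* (p :* r)) refl (𝟙 (X x)) (𝟙 (Y y)) (𝟙 (H y x))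

-- deleteEdge G u v is definitionally λ x y → G x y ∧ not (edgeRel u v x y).
edgeRel : ∀ {n} → Fin n → Fin n → BRel n
edgeRel u v x y = (⌊ x ≟ u ⌋ ∧ ⌊ y ≟ v ⌋) ∨ (⌊ x ≟ v ⌋ ∧ ⌊ y ≟ u ⌋)

toggleEdge : ∀ {n} → BRel n → Fin n → Fin n → BRel n
toggleEdge F t w x y = F x y xor edgeRel t w x y

module _ {n : ℕ} where

  edgeRel-sym : ∀ (u v x y : Fin n) → edgeRel u v x y ≡ edgeRel u v y x
  edgeRel-sym u v x y = begin
    (⌊ x ≟ u ⌋ ∧ ⌊ y ≟ v ⌋) ∨ (⌊ x ≟ v ⌋ ∧ ⌊ y ≟ u ⌋)
      ≡⟨ cong₂ _∨_ (Boolₚ.∧-comm ⌊ x ≟ u ⌋ ⌊ y ≟ v ⌋) (Boolₚ.∧-comm ⌊ x ≟ v ⌋ ⌊ y ≟ u ⌋) ⟩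
    (⌊ y ≟ v ⌋ ∧ ⌊ x ≟ u ⌋) ∨ (⌊ y ≟ u ⌋ ∧ ⌊ x ≟ v ⌋)
      ≡⟨ Boolₚ.∨-comm (⌊ y ≟ v ⌋ ∧ ⌊ x ≟ u ⌋) _ ⟩
    (⌊ y ≟ u ⌋ ∧ ⌊ x ≟ v ⌋) ∨ (⌊ y ≟ v ⌋ ∧ ⌊ x ≟ u ⌋) ∎
    where open ≡-Reasoning

  edgeRel-comm : ∀ (u v x y : Fin n) → edgeRel u v x y ≡ edgeRel v u x y
  edgeRel-comm u v x y = Boolₚ.∨-comm (⌊ x ≟ u ⌋ ∧ ⌊ y ≟ v ⌋) _

  edgeRel-off : ∀ {u v x : Fin n} → x ≢ u → x ≢ v → ∀ y → edgeRel u v x y ≡ false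
  edgeRel-off {u} {v} {x} x≢u x≢v y with x ≟ u | x ≟ v
  ... | yes x≡u | _ = ⊥-elim (x≢u x≡u)
  ... | _ | yes x≡v = ⊥-elim (x≢v x≡v)
  ... | no _ | no _ = refl

  edgeRel-row : ∀ {u v y : Fin n} → u ≢ v → y ≢ v → edgeRel u v u y ≡ false
  edgeRel-row {u} {v} {y} u≢v y≢v with u ≟ u | y ≟ v | u ≟ v
  ... | no u≢u | _ | _ = ⊥-elim (u≢u refl)
  ... | _ | yes y≡v | _ = ⊥-elim (y≢v y≡v)
  ... | _ | _ | yes u≡v = ⊥-elim (u≢v u≡v)
  ... | yes _ | no _ | no _ = refl

  edgeRel-end : ∀ (u v : Fin n) → edgeRel u v u v ≡ true
  edgeRel-end u v with u ≟ u | v ≟ v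
  ... | yes _ | yes _ = refl
  ... | no u≢u | _ = ⊥-elim (u≢u refl)
  ... | _ | no v≢v = ⊥-elim (v≢v refl)

  edgeRel-diag : ∀ {u v : Fin n} → u ≢ v → ∀ x → edgeRel u v x x ≡ false
  edgeRel-diag {u} {v} u≢v x with x ≟ u | x ≟ v
  ... | yes refl | yes refl = ⊥-elim (u≢v refl)
  ... | yes _ | no _ = refl
  ... | no _ | yes _ = refl
  ... | no _ | no _ = refl

  edgeRel-ends : ∀ {u v x y : Fin n} → edgeRel u v x y ≡ true → (x ≡ u × y ≡ v) ⊎ (x ≡ v × y ≡ u)
  edgeRel-ends {u} {v} {x} {y} e with x ≟ u | y ≟ v | x ≟ v | y ≟ u
  ... | yes x≡u | yes y≡v | _ | _ = inj₁ (x≡u , y≡v)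
  ... | _ | _ | yes x≡v | yes y≡u = inj₂ (x≡v , y≡u)

  toggleEdge-comm : ∀ (F : BRel n) t w x y → toggleEdge F t w x y ≡ toggleEdge F w t x y
  toggleEdge-comm F t w x y = cong (F x y xor_) (edgeRel-comm t w x y)

  toggleEdge-off : ∀ (F : BRel n) {t w x} → x ≢ t → x ≢ w → ∀ y → toggleEdge F t w x y ≡ F x y
  toggleEdge-off F x≢t x≢w y =
    trans (cong (F _ y xor_) (edgeRel-off x≢t x≢w y)) (Boolₚ.xor-identityʳ (F _ y))

  toggleEdge-IsSpanningSubgraph : ∀ {F K : BRel n} {t w} → IsSimple K →
    IsSpanningSubgraph F K → K t w ≡ true → IsSpanningSubgraph (toggleEdge F t w) K
  toggleEdge-IsSpanningSubgraph {F} {K} {t} {w} (Ksym , Kloop) ((Fsym , Floop) , F⊆K) Ktw =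
    (symmetric , loopless) , ⊆K
    where
    t≢w : t ≢ w
    t≢w refl with () ← trans (sym Ktw) (Kloop t)
    symmetric : ∀ x y → toggleEdge F t w x y ≡ toggleEdge F t w y x
    symmetric x y = cong₂ _xor_ (Fsym x y) (edgeRel-sym t w x y)
    loopless : ∀ x → toggleEdge F t w x x ≡ false
    loopless x = cong₂ _xor_ (Floop x) (edgeRel-diag t≢w x)
    ⊆K : ∀ x y → toggleEdge F t w x y ≡ true → K x y ≡ true
    ⊆K x y e with edgeRel t w x y in exy
    ... | false = F⊆K x y (trans (sym (Boolₚ.xor-identityʳ (F x y))) e)
    ... | true with edgeRel-ends {t} {w} {x} {y} exy
    ...   | inj₁ (refl , refl) = Ktw
    ...   | inj₂ (refl , refl) = trans (Ksym w t) Ktw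

  deg-toggleEdge-off : ∀ (F : BRel n) {t w x} → x ≢ t → x ≢ w → deg (toggleEdge F t w) x ≡ deg F x
  deg-toggleEdge-off F x≢t x≢w = countV-cong (toggleEdge-off F x≢t x≢w)

  deg-toggleEdge-end : ∀ (F : BRel n) {t w} → t ≢ w →
    deg (toggleEdge F t w) t + 𝟙 (F t w) ≡ deg F t + 𝟙 (not (F t w))
  deg-toggleEdge-end F {t} {w} t≢w =
    trans (countV-update w row) (cong (λ b → deg F t + 𝟙 b) flipped)
    where
    row : ∀ y → y ≢ w → toggleEdge F t w t y ≡ F t y
    row y y≢w = trans (cong (F t y xor_) (edgeRel-row t≢w y≢w)) (Boolₚ.xor-identityʳ (F t y))
    flipped : toggleEdge F t w t w ≡ not (F t w)
    flipped = trans (cong (F t w xor_) (edgeRel-end t w))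
                    (trans (Boolₚ.xor-comm (F t w) true) (Boolₚ.true-xor (F t w)))

  deg-toggleEdge-end′ : ∀ (F : BRel n) {t w} → t ≢ w →
    deg (toggleEdge F t w) w + 𝟙 (F w t) ≡ deg F w + 𝟙 (not (F w t))
  deg-toggleEdge-end′ F {t} {w} t≢w =
    trans (cong (_+ 𝟙 (F w t)) (countV-cong (toggleEdge-comm F t w w)))
          (deg-toggleEdge-end F (t≢w ∘ sym))

  deleteEdge-IsSimple : ∀ {G : BRel n} → IsSimple G → ∀ u v → IsSimple (deleteEdge G u v)
  deleteEdge-IsSimple {G} (Gsym , Gloop) u v =
    (λ x y → cong₂ (λ g e → g ∧ not e) (Gsym x y) (edgeRel-sym u v x y)) ,
    (λ x → cong (λ g → g ∧ not (edgeRel u v x x)) (Gloop x))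

nonNegative⇔ : ∀ x y z → ℤ.+ 0 ℤ.≤ (ℤ.+ x ℤ.- ℤ.+ y) ℤ.+ ℤ.+ z ⇔ y ≤ x + z
nonNegative⇔ x y z = mk⇔
  (λ 0≤δ → ℤₚ.drop‿+≤+ (ℤₚ.0≤i-j⇒j≤i (subst (ℤ.+ 0 ℤ.≤_) δ≡ 0≤δ)))
  (λ y≤x+z → subst (ℤ.+ 0 ℤ.≤_) (sym δ≡) (ℤₚ.i≤j⇒0≤j-i (ℤ.+≤+ y≤x+z)))
  where
  open ℤ-Solver.+-*-Solver
  δ≡ : (ℤ.+ x ℤ.- ℤ.+ y) ℤ.+ ℤ.+ z ≡ ℤ.+ (x + z) ℤ.- ℤ.+ y
  δ≡ = trans (solve 3 (λ x y z → x :- y :+ z := x :+ z :- y) refl (ℤ.+ x) (ℤ.+ y) (ℤ.+ z))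
             (cong (ℤ._- ℤ.+ y) (sym (ℤₚ.pos-+ x z)))

delta-shift : ∀ B A D A′ D′ R → A + D′ + R ≡ A′ + D →
  (ℤ.+ B ℤ.- ℤ.+ A′) ℤ.+ ℤ.+ D′ ≡ ((ℤ.+ B ℤ.- ℤ.+ A) ℤ.+ ℤ.+ D) ℤ.- ℤ.+ R
delta-shift B A D A′ D′ R balance = begin
  (ℤ.+ B ℤ.- ℤ.+ A′) ℤ.+ ℤ.+ D′
    ≡⟨ solve 6 (λ B A D A′ D′ R → B :- A′ :+ D′ := (B :- A :+ D :- R) :+ ((A :+ D′ :+ R) :- (A′ :+ D)))
             refl (ℤ.+ B) (ℤ.+ A) (ℤ.+ D) (ℤ.+ A′) (ℤ.+ D′) (ℤ.+ R) ⟩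
  δ ℤ.+ ((ℤ.+ A ℤ.+ ℤ.+ D′ ℤ.+ ℤ.+ R) ℤ.- (ℤ.+ A′ ℤ.+ ℤ.+ D))
    ≡⟨ cong (λ i → δ ℤ.+ (i ℤ.- (ℤ.+ A′ ℤ.+ ℤ.+ D))) balanceℤ ⟩
  δ ℤ.+ ((ℤ.+ A′ ℤ.+ ℤ.+ D) ℤ.- (ℤ.+ A′ ℤ.+ ℤ.+ D))
    ≡⟨ cong (λ i → δ ℤ.+ i) (ℤₚ.+-inverseʳ (ℤ.+ A′ ℤ.+ ℤ.+ D)) ⟩
  δ ℤ.+ ℤ.+ 0
    ≡⟨ ℤₚ.+-identityʳ δ ⟩
  δ ∎
  where
  open ≡-Reasoning
  open ℤ-Solver.+-*-Solver
  δ : ℤ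
  δ = ((ℤ.+ B ℤ.- ℤ.+ A) ℤ.+ ℤ.+ D) ℤ.- ℤ.+ R
  balanceℤ : ℤ.+ A ℤ.+ ℤ.+ D′ ℤ.+ ℤ.+ R ≡ ℤ.+ A′ ℤ.+ ℤ.+ D
  balanceℤ = begin
    ℤ.+ A ℤ.+ ℤ.+ D′ ℤ.+ ℤ.+ R ≡⟨ cong (ℤ._+ ℤ.+ R) (ℤₚ.pos-+ A D′) ⟨
    ℤ.+ (A + D′) ℤ.+ ℤ.+ R      ≡⟨ ℤₚ.pos-+ (A + D′) R ⟨
    ℤ.+ (A + D′ + R)            ≡⟨ cong ℤ.+_ balance ⟩
    ℤ.+ (A′ + D)                ≡⟨ ℤₚ.pos-+ A′ D ⟩
    ℤ.+ A′ ℤ.+ ℤ.+ D            ∎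

-- A vertex x ∉ S joins T when its degree drops from g = a to k = a - 1; it then adds
-- a to the right-hand side and k + c = a to the left-hand side.
threshold-shift : ∀ a s g k c → 1 ≤ a → g ≡ k + c → c ≤ 1 →
  a * 𝟙 (not s ∧ (g ≤ᵇ a ∸ 1)) + 𝟙 (not s ∧ (k ≤ᵇ a ∸ 1)) * (k + c)
    ≡ a * 𝟙 (not s ∧ (k ≤ᵇ a ∸ 1)) + 𝟙 (not s ∧ (g ≤ᵇ a ∸ 1)) * g
threshold-shift a true g k c _ _ _ = refl
threshold-shift a false g k c 1≤a g≡k+c c≤1
  with g ≤ᵇ a ∸ 1 | ≤ᵇ-reflects-≤ g (a ∸ 1) | k ≤ᵇ a ∸ 1 | ≤ᵇ-reflects-≤ k (a ∸ 1)
... | true | ofʸ _ | true | ofʸ _ = cong (λ m → a * 1 + 1 * m) (sym g≡k+c)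
... | false | ofⁿ _ | false | ofⁿ _ = refl
... | true | ofʸ g≤ | false | ofⁿ k≰ =
  ⊥-elim (k≰ (≤-trans (≤-trans (m≤m+n k c) (≤-reflexive (sym g≡k+c))) g≤))
... | false | ofⁿ g≰ | true | ofʸ k≤ = begin
  a * 0 + 1 * (k + c) ≡⟨ cong₂ _+_ (*-zeroʳ a) (*-identityˡ (k + c)) ⟩
  k + c               ≡⟨ sym g≡k+c ⟩
  g                   ≡⟨ ≤-antisym g≤a a≤g ⟩
  a                   ≡⟨ trans (+-identityʳ (a * 1)) (*-identityʳ a) ⟨
  a * 1 + 0 * g       ∎
  where
  open ≡-Reasoning
  g≤a : g ≤ a
  g≤a = ≤-trans (≤-reflexive g≡k+c) (≤-trans (+-mono-≤ k≤ c≤1) (≤-reflexive (m∸n+n≡m 1≤a)))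
  a≤g : a ≤ g
  a≤g = subst (_≤ g) (m+[n∸m]≡n 1≤a) (≰⇒> g≰)

-- An endpoint in T′ contributes 1 exactly when the other endpoint lies outside S, that is,
-- in T′ or in V - (S ∪ T′).
rho-endpoints : ∀ su bu sv bv → let tu = not su ∧ bu; tv = not sv ∧ bv in
  𝟙 tu * 𝟙 (not sv) + 𝟙 tv * 𝟙 (not su)
    ≡ (if tu ∧ tv then 2 else if (tu ∧ not (sv ∨ tv)) ∨ (tv ∧ not (su ∨ tu)) then 1 else 0)
rho-endpoints true _ true _ = refl
rho-endpoints true _ false true = refl
rho-endpoints true _ false false = refl
rho-endpoints false true true _ = refl
rho-endpoints false false true _ = refl
rho-endpoints false true false true = refl
rho-endpoints false true false false = refl
rho-endpoints false false false true = refl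
rho-endpoints false false false false = refl

module _ {n : ℕ} (a b : ℕ) (1≤a : 1 ≤ a) {G : BRel n} (G-simple : IsSimple G)
         {u v : Fin n} (Guv : G u v ≡ true) (S : VSet n) where

  private
    G′ : BRel n
    G′ = deleteEdge G u v
    T T′ : VSet n
    T = Tset a G S
    T′ = Tset a G′ S
    d d′ : Fin n → ℕ
    d = degMinus G S
    d′ = degMinus G′ S

    u≢v : u ≢ v
    u≢v refl with () ← trans (sym Guv) (proj₂ G-simple u)

  lost : Fin n → ℕ
  lost x = 𝟙 (⌊ x ≟ u ⌋ ∧ not (S v)) + 𝟙 (⌊ x ≟ v ⌋ ∧ not (S u))

  lost≤1 : ∀ x → lost x ≤ 1
  lost≤1 x with x ≟ u | x ≟ v
  ... | yes refl | yes u≡v = ⊥-elim (u≢v u≡v)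
  ... | yes _ | no _ = ≤-trans (≤-reflexive (+-identityʳ _)) (𝟙≤1 (not (S v)))
  ... | no _ | _ = 𝟙≤1 _

  deleteEdge-off : ∀ {x y} → edgeRel u v x y ≡ false → G′ x y ≡ G x y
  deleteEdge-off {x} {y} e = trans (cong (λ β → G x y ∧ not β) e) (Boolₚ.∧-identityʳ (G x y))

  deleteEdge-on : ∀ {x y} → edgeRel u v x y ≡ true → G′ x y ≡ false
  deleteEdge-on {x} {y} e = trans (cong (λ β → G x y ∧ not β) e) (Boolₚ.∧-zeroʳ (G x y))

  degMinus-deleteEdge-end : ∀ {y z} → (∀ w → w ≢ z → G′ y w ≡ G y w) → G′ y z ≡ false →
    G y z ≡ true → d y ≡ d′ y + 𝟙 (not (S z))
  degMinus-deleteEdge-end {y} {z} row G′yz Gyz = begin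
    d y                             ≡⟨ +-identityʳ (d y) ⟨
    d y + 𝟙 false                   ≡⟨ cong (λ β → d y + 𝟙 β) (Boolₚ.∧-zeroʳ (not (S z))) ⟨
    d y + 𝟙 (not (S z) ∧ false)     ≡⟨ cong (λ β → d y + 𝟙 (not (S z) ∧ β)) G′yz ⟨
    d y + 𝟙 (not (S z) ∧ G′ y z)    ≡⟨ countV-update z (λ w w≢z → cong (not (S w) ∧_) (sym (row w w≢z))) ⟩
    d′ y + 𝟙 (not (S z) ∧ G y z)    ≡⟨ cong (λ β → d′ y + 𝟙 (not (S z) ∧ β)) Gyz ⟩
    d′ y + 𝟙 (not (S z) ∧ true)     ≡⟨ cong (λ β → d′ y + 𝟙 β) (Boolₚ.∧-identityʳ (not (S z))) ⟩
    d′ y + 𝟙 (not (S z))            ∎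
    where open ≡-Reasoning

  lost-u : lost u ≡ 𝟙 (not (S v))
  lost-u with u ≟ u | u ≟ v
  ... | no u≢u | _ = ⊥-elim (u≢u refl)
  ... | _ | yes u≡v = ⊥-elim (u≢v u≡v)
  ... | yes _ | no _ = +-identityʳ _

  lost-v : lost v ≡ 𝟙 (not (S u))
  lost-v with v ≟ u | v ≟ v
  ... | yes v≡u | _ = ⊥-elim (u≢v (sym v≡u))
  ... | _ | no v≢v = ⊥-elim (v≢v refl)
  ... | no _ | yes _ = refl

  lost-off : ∀ {x} → x ≢ u → x ≢ v → lost x ≡ 0
  lost-off {x} x≢u x≢v with x ≟ u | x ≟ v
  ... | yes x≡u | _ = ⊥-elim (x≢u x≡u)
  ... | _ | yes x≡v = ⊥-elim (x≢v x≡v)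
  ... | no _ | no _ = refl

  degMinus-deleteEdge : ∀ x → d x ≡ d′ x + lost x
  degMinus-deleteEdge x = by-cases (x ≟ u) (x ≟ v)
    where
    by-cases : Dec (x ≡ u) → Dec (x ≡ v) → d x ≡ d′ x + lost x
    by-cases (yes refl) (yes u≡v) = ⊥-elim (u≢v u≡v)
    by-cases (yes refl) (no _) =
      trans (degMinus-deleteEdge-end (λ w w≢v → deleteEdge-off (edgeRel-row u≢v w≢v))
                                     (deleteEdge-on (edgeRel-end u v)) Guv)
            (cong (d′ u +_) (sym lost-u))
    by-cases (no _) (yes refl) =
      trans (degMinus-deleteEdge-end
              (λ w w≢u → deleteEdge-off (trans (edgeRel-comm u v v w) (edgeRel-row (u≢v ∘ sym) w≢u)))
              (deleteEdge-on (trans (edgeRel-comm u v v u) (edgeRel-end v u)))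
              (trans (proj₁ G-simple v u) Guv))
            (cong (d′ v +_) (sym lost-v))
    by-cases (no x≢u) (no x≢v) =
      trans (countV-cong λ y → cong (not (S y) ∧_) (sym (deleteEdge-off (edgeRel-off x≢u x≢v y))))
            (trans (sym (+-identityʳ (d′ x))) (cong (d′ x +_) (sym (lost-off x≢u x≢v))))

  ∑-lost : ∑[ x < n ] (𝟙 (T′ x) * lost x) ≡ rho a G u v S
  ∑-lost = begin
    ∑[ x < n ] (𝟙 (T′ x) * lost x)
      ≡⟨ sum-cong-≗ split ⟩
    ∑[ x < n ] (𝟙 ⌊ x ≟ u ⌋ * (𝟙 (T′ x) * 𝟙 (not (S v))) + 𝟙 ⌊ x ≟ v ⌋ * (𝟙 (T′ x) * 𝟙 (not (S u))))
      ≡⟨ ∑-distrib-+ (λ x → 𝟙 ⌊ x ≟ u ⌋ * (𝟙 (T′ x) * 𝟙 (not (S v))))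
                     (λ x → 𝟙 ⌊ x ≟ v ⌋ * (𝟙 (T′ x) * 𝟙 (not (S u)))) ⟩
    ∑[ x < n ] (𝟙 ⌊ x ≟ u ⌋ * (𝟙 (T′ x) * 𝟙 (not (S v))))
      + ∑[ x < n ] (𝟙 ⌊ x ≟ v ⌋ * (𝟙 (T′ x) * 𝟙 (not (S u))))
      ≡⟨ cong₂ _+_ (∑-pick u (λ x → 𝟙 (T′ x) * 𝟙 (not (S v))))
                   (∑-pick v (λ x → 𝟙 (T′ x) * 𝟙 (not (S u)))) ⟩
    𝟙 (T′ u) * 𝟙 (not (S v)) + 𝟙 (T′ v) * 𝟙 (not (S u))
      ≡⟨ rho-endpoints (S u) _ (S v) _ ⟩
    rho a G u v S ∎
    where
    open ≡-Reasoning
    open ℕ-Solver.+-*-Solver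
    split : ∀ x → 𝟙 (T′ x) * lost x
      ≡ 𝟙 ⌊ x ≟ u ⌋ * (𝟙 (T′ x) * 𝟙 (not (S v))) + 𝟙 ⌊ x ≟ v ⌋ * (𝟙 (T′ x) * 𝟙 (not (S u)))
    split x
      rewrite 𝟙-∧ ⌊ x ≟ u ⌋ (not (S v)) | 𝟙-∧ ⌊ x ≟ v ⌋ (not (S u)) =
      solve 5 (λ t p q r s → t :* (p :* q :+ r :* s) := p :* (t :* q) :+ r :* (t :* s)) refl
        (𝟙 (T′ x)) (𝟙 ⌊ x ≟ u ⌋) (𝟙 (not (S v))) (𝟙 ⌊ x ≟ v ⌋) (𝟙 (not (S u)))

  deletion-balance : a * card T + sumOver T′ d′ + rho a G u v S ≡ a * card T′ + sumOver T d
  deletion-balance = begin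
    a * card T + sumOver T′ d′ + rho a G u v S
      ≡⟨ cong₂ _+_ (cong₂ _+_ (*-card a T) (sumOver≡∑ T′ d′)) (sym ∑-lost) ⟩
    ∑[ x < n ] (a * 𝟙 (T x)) + ∑[ x < n ] (𝟙 (T′ x) * d′ x) + ∑[ x < n ] (𝟙 (T′ x) * lost x)
      ≡⟨ +-assoc (∑[ x < n ] (a * 𝟙 (T x))) _ _ ⟩
    ∑[ x < n ] (a * 𝟙 (T x)) + (∑[ x < n ] (𝟙 (T′ x) * d′ x) + ∑[ x < n ] (𝟙 (T′ x) * lost x))
      ≡⟨ cong (∑[ x < n ] (a * 𝟙 (T x)) +_)
              (∑-distrib-+ (λ x → 𝟙 (T′ x) * d′ x) (λ x → 𝟙 (T′ x) * lost x)) ⟨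
    ∑[ x < n ] (a * 𝟙 (T x)) + ∑[ x < n ] (𝟙 (T′ x) * d′ x + 𝟙 (T′ x) * lost x)
      ≡⟨ ∑-distrib-+ (λ x → a * 𝟙 (T x)) (λ x → 𝟙 (T′ x) * d′ x + 𝟙 (T′ x) * lost x) ⟨
    ∑[ x < n ] (a * 𝟙 (T x) + (𝟙 (T′ x) * d′ x + 𝟙 (T′ x) * lost x))
      ≡⟨ sum-cong-≗ balance-at ⟩
    ∑[ x < n ] (a * 𝟙 (T′ x) + 𝟙 (T x) * d x)
      ≡⟨ ∑-distrib-+ (λ x → a * 𝟙 (T′ x)) (λ x → 𝟙 (T x) * d x) ⟩
    ∑[ x < n ] (a * 𝟙 (T′ x)) + ∑[ x < n ] (𝟙 (T x) * d x)
      ≡⟨ cong₂ _+_ (*-card a T′) (sumOver≡∑ T d) ⟨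
    a * card T′ + sumOver T d ∎
    where
    open ≡-Reasoning
    balance-at : ∀ x → a * 𝟙 (T x) + (𝟙 (T′ x) * d′ x + 𝟙 (T′ x) * lost x) ≡ a * 𝟙 (T′ x) + 𝟙 (T x) * d x
    balance-at x = trans (cong (a * 𝟙 (T x) +_) (sym (*-distribˡ-+ (𝟙 (T′ x)) (d′ x) (lost x))))
      (threshold-shift a (S x) (d x) (d′ x) (lost x) 1≤a (degMinus-deleteEdge x) (lost≤1 x))

  delta-deleteEdge : delta a b G′ S ≡ delta a b G S ℤ.- ℤ.+ rho a G u v S
  delta-deleteEdge = delta-shift (b * card S) (a * card T) (sumOver T d) (a * card T′) (sumOver T′ d′)
                                 (rho a G u v S) deletion-balance

module _ {n : ℕ} {a b : ℕ} {K H : BRel n} (H-factor : IsFactor a b K H) (S : VSet n) where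

  private
    T : VSet n
    T = Tset a K S
    Hsym : ∀ x y → H x y ≡ H y x
    Hsym = proj₁ (proj₁ (proj₁ H-factor))
    H⊆K : ∀ x y → H x y ≡ true → K x y ≡ true
    H⊆K = proj₂ (proj₁ H-factor)

  factor-inequality : a * card T ≤ b * card S + sumOver T (degMinus K S)
  factor-inequality = begin
    a * card T
      ≡⟨ sumOver-const T a ⟨
    sumOver T (λ _ → a)
      ≤⟨ sumOver-mono (λ x _ → ≤-trans (proj₁ (proj₂ H-factor x)) (≤-reflexive (countV-split S (H x)))) ⟩
    sumOver T (λ x → countV (λ y → S y ∧ H x y) + countV (λ y → not (S y) ∧ H x y))
      ≡⟨ sumOver-+ T _ _ ⟩
    sumOver T (λ x → countV (λ y → S y ∧ H x y)) + sumOver T (λ x → countV (λ y → not (S y) ∧ H x y))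
      ≡⟨ cong (_+ sumOver T (λ x → countV (λ y → not (S y) ∧ H x y))) (double-count Hsym T S) ⟩
    sumOver S (λ y → countV (λ x → T x ∧ H y x)) + sumOver T (λ x → countV (λ y → not (S y) ∧ H x y))
      ≤⟨ +-mono-≤ (sumOver-mono (λ y _ → ≤-trans (countV-mono (λ x → Boolₚ.∧-conicalʳ (T x) (H y x)))
                                                  (proj₂ (proj₂ H-factor y))))
                  (sumOver-mono (λ x _ → countV-mono (λ y → ∧-mapʳ (H⊆K x y)))) ⟩
    sumOver S (λ _ → b) + sumOver T (degMinus K S)
      ≡⟨ cong (_+ sumOver T (degMinus K S)) (sumOver-const S b) ⟩
    b * card S + sumOver T (degMinus K S) ∎
    where open ≤-Reasoning

lovasz-necessary : ∀ {n a b} {K : BRel n} → HasFactor a b K → ∀ S → ℤ.+ 0 ℤ.≤ delta a b K S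
lovasz-necessary {b = b} {K} (H , H-factor) S =
  Equivalence.from (nonNegative⇔ (b * card S) _ _) (factor-inequality H-factor S)

-- T(S) is the set of x ∉ S with a - d(x) > 0, so it maximises Σ_{x ∈ X} (a - d(x)).
threshold-maximises : ∀ a s χ d → (χ ≡ true → s ≡ false) →
  𝟙 χ * a + 𝟙 (not s ∧ (d ≤ᵇ a ∸ 1)) * d ≤ 𝟙 (not s ∧ (d ≤ᵇ a ∸ 1)) * a + 𝟙 χ * d
threshold-maximises a true false d _ = z≤n
threshold-maximises a true true d χ⇒¬s with () ← χ⇒¬s refl
threshold-maximises a false χ d _ with d ≤ᵇ a ∸ 1 | ≤ᵇ-reflects-≤ d (a ∸ 1) | χ
... | true | ofʸ _ | true = ≤-refl
... | true | ofʸ d≤a∸1 | false = +-mono-≤ (≤-trans d≤a∸1 (≤-trans (m∸n≤m a 1) (m≤m+n a 0))) z≤n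
... | false | ofⁿ d≰a∸1 | true =
  +-mono-≤ (≤-trans (≤-reflexive (+-identityʳ a)) (≤-trans (m≤n+m∸n a 1) (≰⇒> d≰a∸1))) z≤n
... | false | ofⁿ _ | false = z≤n

module _ {n : ℕ} (a b : ℕ) {K : BRel n} (S : VSet n) where

  private
    T : VSet n
    T = Tset a K S
    d : Fin n → ℕ
    d = degMinus K S

  Tset-maximises : ∀ (X : VSet n) → (∀ x → X x ≡ true → S x ≡ false) →
    a * card X + sumOver T d ≤ a * card T + sumOver X d
  Tset-maximises X X∩S≡∅ = begin
    a * card X + sumOver T d
      ≡⟨ cong₂ _+_ (trans (sym (sumOver-const X a)) (sumOver≡∑ X (λ _ → a))) (sumOver≡∑ T d) ⟩
    ∑[ x < n ] (𝟙 (X x) * a) + ∑[ x < n ] (𝟙 (T x) * d x)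
      ≡⟨ ∑-distrib-+ (λ x → 𝟙 (X x) * a) (λ x → 𝟙 (T x) * d x) ⟨
    ∑[ x < n ] (𝟙 (X x) * a + 𝟙 (T x) * d x)
      ≤⟨ ∑-mono-≤ (λ x → threshold-maximises a (S x) (X x) (d x) (X∩S≡∅ x)) ⟩
    ∑[ x < n ] (𝟙 (T x) * a + 𝟙 (X x) * d x)
      ≡⟨ ∑-distrib-+ (λ x → 𝟙 (T x) * a) (λ x → 𝟙 (X x) * d x) ⟩
    ∑[ x < n ] (𝟙 (T x) * a) + ∑[ x < n ] (𝟙 (X x) * d x)
      ≡⟨ cong₂ _+_ (trans (sym (sumOver-const T a)) (sumOver≡∑ T (λ _ → a))) (sumOver≡∑ X d) ⟨
    a * card T + sumOver X d ∎
    where open ≤-Reasoning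

  disjoint-bound : ℤ.+ 0 ℤ.≤ delta a b K S → ∀ (X : VSet n) → (∀ x → X x ≡ true → S x ≡ false) →
    a * card X ≤ b * card S + sumOver X d
  disjoint-bound 0≤δ X X∩S≡∅ = +-cancelʳ-≤ (sumOver T d) (a * card X) (b * card S + sumOver X d) (begin
    a * card X + sumOver T d               ≤⟨ Tset-maximises X X∩S≡∅ ⟩
    a * card T + sumOver X d               ≤⟨ +-monoˡ-≤ (sumOver X d) (Equivalence.to (nonNegative⇔ _ _ _) 0≤δ) ⟩
    b * card S + sumOver T d + sumOver X d ≡⟨ xy∙z≈xz∙y (b * card S) (sumOver T d) (sumOver X d) ⟩
    b * card S + sumOver X d + sumOver T d ∎)
    where open ≤-Reasoning

module _ {n : ℕ} {K H : BRel n} (H-sub : IsSpanningSubgraph H K) (E O : VSet n)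
  (E-closed : ∀ t w → E t ≡ true → K t w ≡ true → H t w ≡ false → O w ≡ true)
  (O-closed : ∀ y x → O y ≡ true → H y x ≡ true → E x ≡ true) where

  closed-degree-sum : ∀ {b} → (∀ y → O y ≡ true → deg H y ≡ b) →
    sumOver E (deg H) ≡ b * card O + sumOver E (degMinus K O)
  closed-degree-sum {b} O-full = begin
    sumOver E (deg H)
      ≡⟨ sumOver-cong (λ t _ → countV-split O (H t)) ⟩
    sumOver E (λ t → countV (λ y → O y ∧ H t y) + countV (λ y → not (O y) ∧ H t y))
      ≡⟨ sumOver-+ E _ _ ⟩
    sumOver E (λ t → countV (λ y → O y ∧ H t y)) + sumOver E (λ t → countV (λ y → not (O y) ∧ H t y))
      ≡⟨ cong₂ _+_ (double-count (proj₁ (proj₁ H-sub)) E O)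
                   (sumOver-cong (λ t Et → countV-cong (λ y → outside t y Et))) ⟩
    sumOver O (λ y → countV (λ x → E x ∧ H y x)) + sumOver E (degMinus K O)
      ≡⟨ cong (_+ sumOver E (degMinus K O))
              (sumOver-cong (λ y Oy → trans (countV-cong (λ x → into-E y x Oy)) (O-full y Oy))) ⟩
    sumOver O (λ _ → b) + sumOver E (degMinus K O)
      ≡⟨ cong (_+ sumOver E (degMinus K O)) (sumOver-const O b) ⟩
    b * card O + sumOver E (degMinus K O) ∎
    where
    open ≡-Reasoning
    outside : ∀ t y → E t ≡ true → (not (O y) ∧ H t y) ≡ (not (O y) ∧ K t y)
    outside t y Et with O y in Oy
    ... | true = refl
    ... | false with H t y in Hty | K t y in Kty
    ...   | true | true = refl
    ...   | false | false = refl
    ...   | true | false with () ← trans (sym (proj₂ H-sub t y Hty)) Kty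
    ...   | false | true with () ← trans (sym (E-closed t y Et Kty Hty)) Oy
    into-E : ∀ y x → O y ≡ true → (E x ∧ H y x) ≡ H y x
    into-E y x Oy with H y x in Hyx
    ... | true = cong (_∧ true) (O-closed y x Oy Hyx)
    ... | false = Boolₚ.∧-zeroʳ (E x)

module _ {n : ℕ} (a b : ℕ) (K : BRel n) where

  IsBoundedSubgraph : BRel n → Set
  IsBoundedSubgraph A = IsSpanningSubgraph A K × (∀ x → deg A x ≤ b)

deficiency : ∀ {n} → ℕ → BRel n → ℕ
deficiency {n} a A = ∑[ x < n ] (a ∸ deg A x)

module Augmentation {n : ℕ} {a b : ℕ} (a<b : a < b) {K : BRel n} (K-simple : IsSimple K)
  {H : BRel n} (H-bounded : IsBoundedSubgraph a b K H) (x0 : Fin n) (x0-deficient : deg H x0 < a) where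

  open import Data.List.Membership.DecPropositional (_≟_ {n}) using (_∈?_)

  private
    H-sub : IsSpanningSubgraph H K
    H-sub = proj₁ H-bounded
    Hsym : ∀ x y → H x y ≡ H y x
    Hsym = proj₁ (proj₁ H-sub)

  -- The parity of an alternating path is the kind of edge it takes next: false for an
  -- edge of K outside H (to be added), true for an edge of H (to be removed).  Every
  -- vertex after x0 is Tight: it cannot absorb the change that the path makes there.
  AltEdge : Bool → Fin n → Fin n → Set
  AltEdge false t w = K t w ≡ true × H t w ≡ false
  AltEdge true t w = H t w ≡ true

  altEdge-K : ∀ p {t w} → AltEdge p t w → K t w ≡ true
  altEdge-K false = proj₁
  altEdge-K true = proj₂ H-sub _ _

  altEdge-H : ∀ p {t w} → AltEdge p t w → H t w ≡ p
  altEdge-H false = proj₂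
  altEdge-H true Htw = Htw

  altEdge-≢ : ∀ p {t w} → AltEdge p t w → t ≢ w
  altEdge-≢ p {t} e refl with () ← trans (sym (altEdge-K p e)) (proj₂ K-simple t)

  Tight : Bool → Fin n → Set
  Tight false w = deg H w ≤ a
  Tight true w = b ≤ deg H w

  tight? : ∀ p w → Dec (Tight p w)
  tight? false w = deg H w ≤? a
  tight? true w = b ≤? deg H w

  data AltPath : Bool → Fin n → List (Fin n) → Set where
    start : AltPath false x0 (x0 ∷ [])
    extend : ∀ {p t vs w} → AltPath p t vs → w ∉ vs → AltEdge p t w → Tight (not p) w →
             AltPath (not p) w (w ∷ vs)

  x0∈ : ∀ {p t vs} → AltPath p t vs → x0 ∈ vs
  x0∈ start = here refl
  x0∈ (extend g _ _ _) = there (x0∈ g)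

  end∈ : ∀ {p t vs} → AltPath p t vs → t ∈ vs
  end∈ start = here refl
  end∈ (extend _ _ _ _) = here refl

  x0-parity : ∀ {p vs} → AltPath p x0 vs → p ≡ false
  x0-parity start = refl
  x0-parity (extend g x0∉vs _ _) = ⊥-elim (x0∉vs (x0∈ g))

  x0-vertices : ∀ {p vs} → AltPath p x0 vs → vs ≡ x0 ∷ []
  x0-vertices start = refl
  x0-vertices (extend g x0∉vs _ _) = ⊥-elim (x0∉vs (x0∈ g))

  end-tight : ∀ {p t vs} → AltPath p t vs → t ≢ x0 → Tight p t
  end-tight start t≢x0 = ⊥-elim (t≢x0 refl)
  end-tight (extend _ _ _ w-tight) _ = w-tight

  prefix : ∀ {p t vs w} → AltPath p t vs → w ∈ vs → ∃₂ λ q vs′ → AltPath q w vs′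
  prefix start (here refl) = _ , _ , start
  prefix (extend g w∉vs e w-tight) (here refl) = _ , _ , extend g w∉vs e w-tight
  prefix (extend g _ _ _) (there w∈vs) = prefix g w∈vs

  flipped : ∀ {p t vs} → AltPath p t vs → BRel n
  flipped start = H
  flipped (extend {t = t} {w = w} g _ _ _) = toggleEdge (flipped g) t w

  flipped-sub : ∀ {p t vs} (g : AltPath p t vs) → IsSpanningSubgraph (flipped g) K
  flipped-sub start = H-sub
  flipped-sub (extend {p = p} g _ e _) =
    toggleEdge-IsSpanningSubgraph K-simple (flipped-sub g) (altEdge-K p e)

  flipped-off : ∀ {p t vs} (g : AltPath p t vs) {x} → x ∉ vs → ∀ y → flipped g x y ≡ H x y
  flipped-off start x∉vs y = refl
  flipped-off (extend g _ _ _) x∉vs y =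
    trans (toggleEdge-off (flipped g) (λ { refl → x∉vs (there (end∈ g)) }) (x∉vs ∘ here) y)
          (flipped-off g (x∉vs ∘ there) y)

  flipped-head : ∀ {p t vs w} (g : AltPath p t vs) → AltEdge p t w → flipped g t w ≡ H t w
  flipped-head start _ = refl
  flipped-head {w = w} (extend {p = p₀} {t = t₀} {w = t} g t∉vs₀ e₀ _) e = begin
    flipped g t w xor edgeRel t₀ t t w  ≡⟨ cong (flipped g t w xor_) (edgeRel-comm t₀ t t w) ⟩
    flipped g t w xor edgeRel t t₀ t w  ≡⟨ cong (flipped g t w xor_) (edgeRel-row (altEdge-≢ p₀ e₀ ∘ sym) w≢t₀) ⟩
    flipped g t w xor false             ≡⟨ Boolₚ.xor-identityʳ _ ⟩
    flipped g t w                       ≡⟨ flipped-off g t∉vs₀ w ⟩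
    H t w                               ∎
    where
    open ≡-Reasoning
    w≢t₀ : w ≢ t₀
    w≢t₀ refl = Boolₚ.not-¬ refl (trans (sym (altEdge-H p₀ e₀)) (trans (Hsym t₀ t) (altEdge-H (not p₀) e)))

  record FlipDegrees (A : BRel n) (p : Bool) (t : Fin n) (vs : List (Fin n)) : Set where
    field
      off-path : ∀ x → x ∉ vs → deg A x ≡ deg H x
      interior : ∀ x → x ∈ vs → x ≢ t → x ≢ x0 → deg A x ≡ deg H x
      start-unmoved : t ≡ x0 → deg A x0 ≡ deg H x0
      start-raised : t ≢ x0 → deg A x0 ≡ suc (deg H x0)
      end-shifted : t ≢ x0 → deg A t + 𝟙 (not p) ≡ deg H t + 𝟙 p

  module Step {p t vs w} (g : AltPath p t vs) (D : FlipDegrees (flipped g) p t vs) (e : AltEdge p t w) where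
    open FlipDegrees D

    toggled : BRel n
    toggled = toggleEdge (flipped g) t w

    private
      F : BRel n
      F = flipped g
      t≢w : t ≢ w
      t≢w = altEdge-≢ p e
      Ftw : F t w ≡ p
      Ftw = trans (flipped-head g e) (altEdge-H p e)

    at-t : deg toggled t + 𝟙 p ≡ deg F t + 𝟙 (not p)
    at-t = subst (λ β → deg toggled t + 𝟙 β ≡ deg F t + 𝟙 (not β)) Ftw (deg-toggleEdge-end F t≢w)

    at-w : deg toggled w + 𝟙 p ≡ deg F w + 𝟙 (not p)
    at-w = subst (λ β → deg toggled w + 𝟙 β ≡ deg F w + 𝟙 (not β))
                 (trans (proj₁ (proj₁ (flipped-sub g)) w t) Ftw) (deg-toggleEdge-end′ F t≢w)

    away : ∀ x → x ≢ x0 → x ≢ w → deg toggled x ≡ deg H x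
    away x x≢x0 x≢w = by-cases (x ≟ t)
      where
      by-cases : Dec (x ≡ t) → deg toggled x ≡ deg H x
      by-cases (yes refl) = +-cancelʳ-≡ (𝟙 p) (deg toggled x) (deg H x) (trans at-t (end-shifted x≢x0))
      by-cases (no x≢t) with x ∈? vs
      ... | yes x∈vs = trans (deg-toggleEdge-off F x≢t x≢w) (interior x x∈vs x≢t x≢x0)
      ... | no x∉vs = trans (deg-toggleEdge-off F x≢t x≢w) (off-path x x∉vs)

    at-x0 : w ≢ x0 → deg toggled x0 ≡ suc (deg H x0)
    at-x0 w≢x0 = by-cases (t ≟ x0)
      where
      by-cases : Dec (t ≡ x0) → deg toggled x0 ≡ suc (deg H x0)
      by-cases (yes refl) with refl ← x0-parity g = begin
        deg toggled x0      ≡⟨ +-identityʳ (deg toggled x0) ⟨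
        deg toggled x0 + 0  ≡⟨ at-t ⟩
        deg F x0 + 1        ≡⟨ +-comm (deg F x0) 1 ⟩
        suc (deg F x0)      ≡⟨ cong suc (start-unmoved refl) ⟩
        suc (deg H x0)      ∎
        where open ≡-Reasoning
      by-cases (no t≢x0) = trans (deg-toggleEdge-off F (t≢x0 ∘ sym) (w≢x0 ∘ sym)) (start-raised t≢x0)

  extend-degrees : ∀ {p t vs w} (g : AltPath p t vs) → FlipDegrees (flipped g) p t vs → w ∉ vs →
    (e : AltEdge p t w) → FlipDegrees (toggleEdge (flipped g) t w) (not p) w (w ∷ vs)
  extend-degrees {p} {t} {vs} {w} g D w∉vs e = record
    { off-path = λ x x∉ → away x (λ { refl → x∉ (there (x0∈ g)) }) (x∉ ∘ here)
    ; interior = λ x _ x≢w x≢x0 → away x x≢x0 x≢w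
    ; start-unmoved = λ { refl → ⊥-elim (w∉vs (x0∈ g)) }
    ; start-raised = at-x0
    ; end-shifted = λ _ → subst (λ β → deg toggled w + 𝟙 β ≡ deg H w + 𝟙 (not p))
                               (sym (Boolₚ.not-involutive p))
                               (trans at-w (cong (_+ 𝟙 (not p)) (FlipDegrees.off-path D w w∉vs)))
    }
    where open Step g D e

  flip-degrees : ∀ {p t vs} (g : AltPath p t vs) → FlipDegrees (flipped g) p t vs
  flip-degrees start = record
    { off-path = λ _ _ → refl
    ; interior = λ _ _ _ _ → refl
    ; start-unmoved = λ _ → refl
    ; start-raised = λ x0≢x0 → ⊥-elim (x0≢x0 refl)
    ; end-shifted = λ x0≢x0 → ⊥-elim (x0≢x0 refl)
    }
  flip-degrees (extend g w∉vs e _) = extend-degrees g (flip-degrees g) w∉vs e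

  NoWorse : BRel n → Fin n → Set
  NoWorse A x = deg A x ≤ b × a ∸ deg A x ≤ a ∸ deg H x

  Improved : BRel n → Set
  Improved A = IsBoundedSubgraph a b K A × deficiency a A < deficiency a H

  unchanged : ∀ {A x} → deg A x ≡ deg H x → NoWorse A x
  unchanged {A} {x} same = subst (_≤ b) (sym same) (proj₂ H-bounded x) , ≤-reflexive (cong (a ∸_) same)

  improved : ∀ {A} → IsSpanningSubgraph A K → (∀ x → x ≢ x0 → NoWorse A x) →
    deg H x0 < deg A x0 → deg A x0 ≤ b → Improved A
  improved {A} A-sub noWorse raised A-x0≤b = (A-sub , bounded) , ∑-mono-< x0 pointwise lowered
    where
    bounded : ∀ x → deg A x ≤ b
    bounded x with x ≟ x0
    ... | yes refl = A-x0≤b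
    ... | no x≢x0 = proj₁ (noWorse x x≢x0)
    pointwise : ∀ x → a ∸ deg A x ≤ a ∸ deg H x
    pointwise x with x ≟ x0
    ... | yes refl = ∸-monoʳ-≤ a (<⇒≤ raised)
    ... | no x≢x0 = proj₂ (noWorse x x≢x0)
    lowered : a ∸ deg A x0 < a ∸ deg H x0
    lowered = ≤-<-trans (∸-monoʳ-≤ a raised) (∸-monoʳ-< (n<1+n (deg H x0)) x0-deficient)

  raised-once : ∀ {A} → deg A x0 ≡ suc (deg H x0) → deg H x0 < deg A x0 × deg A x0 ≤ b
  raised-once up = ≤-reflexive (sym up) , subst (_≤ b) (sym up) (<-trans x0-deficient a<b)

  raised-twice : ∀ {A} → deg A x0 ≡ suc (suc (deg H x0)) → deg H x0 < deg A x0 × deg A x0 ≤ b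
  raised-twice up =
    ≤-trans (n≤1+n _) (≤-reflexive (sym up)) , subst (_≤ b) (sym up) (≤-trans (s≤s x0-deficient) a<b)

  Slack : Bool → Fin n → Set
  Slack false w = suc (deg H w) ≤ b
  Slack true w = a < deg H w

  shifted-noWorse : ∀ {A p w} → deg A w + 𝟙 p ≡ deg H w + 𝟙 (not p) → Slack p w → NoWorse A w
  shifted-noWorse {A} {false} {w} shift slack =
    subst (_≤ b) (sym up) slack , subst (λ k → a ∸ k ≤ a ∸ deg H w) (sym up) (∸-monoʳ-≤ a (n≤1+n _))
    where
    up : deg A w ≡ suc (deg H w)
    up = trans (sym (+-identityʳ _)) (trans shift (+-comm _ 1))
  shifted-noWorse {A} {true} {w} shift slack =
    ≤-trans (n≤1+n _) (subst (_≤ b) (sym down) (proj₂ H-bounded w)) ,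
    ≤-trans (≤-reflexive (m≤n⇒m∸n≡0 (≤-pred (subst (a <_) (sym down) slack)))) z≤n
    where
    down : suc (deg A w) ≡ deg H w
    down = trans (+-comm 1 _) (trans shift (+-identityʳ _))

  loose-slack : ∀ p {w} → ¬ Tight (not p) w → Slack p w
  loose-slack false loose = ≰⇒> loose
  loose-slack true loose = ≰⇒> loose

  tight-slack : ∀ p {w} → Tight p w → Slack p w
  tight-slack false tight = ≤-trans (s≤s tight) a<b
  tight-slack true tight = <-≤-trans a<b tight

  augment-fresh : ∀ {p t vs w} (g : AltPath p t vs) → w ∉ vs → (e : AltEdge p t w) →
    ¬ Tight (not p) w → Improved (toggleEdge (flipped g) t w)
  augment-fresh {p} {t} {vs} {w} g w∉vs e loose =
    improved (toggleEdge-IsSpanningSubgraph K-simple (flipped-sub g) (altEdge-K p e)) noWorse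
             (proj₁ x0-gain) (proj₂ x0-gain)
    where
    open Step g (flip-degrees g) e
    w≢x0 : w ≢ x0
    w≢x0 refl = w∉vs (x0∈ g)
    x0-gain : deg H x0 < deg toggled x0 × deg toggled x0 ≤ b
    x0-gain = raised-once {toggled} (at-x0 w≢x0)
    noWorse : ∀ x → x ≢ x0 → NoWorse toggled x
    noWorse x x≢x0 = by-cases (x ≟ w)
      where
      by-cases : Dec (x ≡ w) → NoWorse toggled x
      by-cases (yes refl) =
        shifted-noWorse {toggled}
          (trans at-w (cong (_+ 𝟙 (not p)) (FlipDegrees.off-path (flip-degrees g) x w∉vs)))
          (loose-slack p loose)
      by-cases (no x≢w) = unchanged {toggled} (away x x≢x0 x≢w)

  -- w is tight for p, and since a < b it can still absorb the change of kind p.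
  augment-revisit : ∀ {p t vs w vs′} (g : AltPath p t vs) → w ∈ vs → (e : AltEdge p t w) →
    AltPath p w vs′ → Improved (toggleEdge (flipped g) t w)
  augment-revisit {p} {t} {vs} {w} g w∈vs e g′ =
    improved (toggleEdge-IsSpanningSubgraph K-simple (flipped-sub g) (altEdge-K p e)) noWorse
             (proj₁ x0-gain) (proj₂ x0-gain)
    where
    open Step g (flip-degrees g) e
    open FlipDegrees (flip-degrees g)
    t≢x0 : t ≢ x0
    t≢x0 refl with refl ← x0-vertices g = lone w∈vs
      where
      lone : w ∈ x0 ∷ [] → ⊥
      lone (here w≡x0) = altEdge-≢ p e (sym w≡x0)
    x0-gain : deg H x0 < deg toggled x0 × deg toggled x0 ≤ b
    x0-gain = by-cases (w ≟ x0)
      where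
      by-cases : Dec (w ≡ x0) → deg H x0 < deg toggled x0 × deg toggled x0 ≤ b
      by-cases (no w≢x0) = raised-once {toggled} (at-x0 w≢x0)
      by-cases (yes refl) with refl ← x0-parity g′ = raised-twice {toggled} (begin
        deg toggled x0              ≡⟨ +-identityʳ _ ⟨
        deg toggled x0 + 0          ≡⟨ at-w ⟩
        deg (flipped g) x0 + 1      ≡⟨ +-comm _ 1 ⟩
        suc (deg (flipped g) x0)    ≡⟨ cong suc (start-raised t≢x0) ⟩
        suc (suc (deg H x0))        ∎)
        where open ≡-Reasoning
    noWorse : ∀ x → x ≢ x0 → NoWorse toggled x
    noWorse x x≢x0 = by-cases (x ≟ w)
      where
      by-cases : Dec (x ≡ w) → NoWorse toggled x
      by-cases (yes refl) =
        shifted-noWorse {toggled}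
          (trans at-w (cong (_+ 𝟙 (not p)) (interior x w∈vs (altEdge-≢ p e ∘ sym) x≢x0)))
          (tight-slack p (end-tight g′ x≢x0))
      by-cases (no x≢w) = unchanged {toggled} (away x x≢x0 x≢w)

  record Labelling : Set where
    field
      label : Bool → VSet n
      reached : ∀ {p w} → label p w ≡ true → ∃ (AltPath p w)
      x0-labelled : label false x0 ≡ true
  open Labelling

  Frontier : Labelling → Bool → Fin n → Fin n → Set
  Frontier L p t w = label L p t ≡ true × AltEdge p t w × label L (not p) w ≡ false

  altEdge? : ∀ p t w → Dec (AltEdge p t w)
  altEdge? false t w = (K t w Boolₚ.≟ true) ×-dec (H t w Boolₚ.≟ false)
  altEdge? true t w = H t w Boolₚ.≟ true

  frontier-at? : ∀ L p t w → Dec (Frontier L p t w)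
  frontier-at? L p t w =
    (label L p t Boolₚ.≟ true) ×-dec altEdge? p t w ×-dec (label L (not p) w Boolₚ.≟ false)

  frontier? : ∀ L → Dec (∃ λ p → ∃₂ (Frontier L p))
  frontier? L with Finₚ.any? (λ t → Finₚ.any? (frontier-at? L false t))
                 | Finₚ.any? (λ t → Finₚ.any? (frontier-at? L true t))
  ... | yes (t , w , f) | _ = yes (false , t , w , f)
  ... | no _ | yes (t , w , f) = yes (true , t , w , f)
  ... | no none-even | no none-odd = no λ
    { (false , t , w , f) → none-even (t , w , f)
    ; (true , t , w , f) → none-odd (t , w , f) }

  stuck-impossible : (∀ S → ℤ.+ 0 ℤ.≤ delta a b K S) → (L : Labelling) →
    ¬ (∃ λ p → ∃₂ (Frontier L p)) → ⊥
  stuck-impossible condition L stuck = <⇒≱ E-deficit (disjoint-bound a b O (condition O) E E∩O≡∅)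
    where
    E O : VSet n
    E = label L false
    O = label L true
    E-closed : ∀ t w → E t ≡ true → K t w ≡ true → H t w ≡ false → O w ≡ true
    E-closed t w Et Ktw Htw with O w in Ow
    ... | true = refl
    ... | false = ⊥-elim (stuck (false , t , w , Et , (Ktw , Htw) , Ow))
    O-closed : ∀ y x → O y ≡ true → H y x ≡ true → E x ≡ true
    O-closed y x Oy Hyx with E x in Ex
    ... | true = refl
    ... | false = ⊥-elim (stuck (true , y , x , Oy , Hyx , Ex))
    odd≢x0 : ∀ {y} → O y ≡ true → y ≢ x0
    odd≢x0 Oy refl with () ← x0-parity (proj₂ (reached L Oy))
    O-full : ∀ y → O y ≡ true → deg H y ≡ b
    O-full y Oy = ≤-antisym (proj₂ H-bounded y) (end-tight (proj₂ (reached L Oy)) (odd≢x0 Oy))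
    E-low : ∀ t → E t ≡ true → deg H t ≤ a
    E-low t Et with t ≟ x0
    ... | yes refl = <⇒≤ x0-deficient
    ... | no t≢x0 = end-tight (proj₂ (reached L Et)) t≢x0
    E∩O≡∅ : ∀ x → E x ≡ true → O x ≡ false
    E∩O≡∅ x Ex with O x in Ox
    ... | false = refl
    ... | true = ⊥-elim (<⇒≱ a<b (≤-trans (≤-reflexive (sym (O-full x Ox))) (E-low x Ex)))
    E-deficit : b * card O + sumOver E (degMinus K O) < a * card E
    E-deficit = begin-strict
      b * card O + sumOver E (degMinus K O) ≡⟨ closed-degree-sum H-sub E O E-closed O-closed O-full ⟨
      sumOver E (deg H)                      <⟨ sumOver-mono-< x0 E-low (x0-labelled L) x0-deficient ⟩
      sumOver E (λ _ → a)                    ≡⟨ sumOver-const E a ⟩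
      a * card E                             ∎
      where open ≤-Reasoning

  unlabelled : Labelling → ℕ
  unlabelled L = ∑[ x < n ] (𝟙 (not (label L false x)) + 𝟙 (not (label L true x)))

  add-label : (L : Labelling) → ∀ p w → label L p w ≡ false → ∃ (AltPath p w) →
    Σ Labelling λ L′ → unlabelled L′ < unlabelled L
  add-label L p w Lw path = L′ , ∑-mono-< w (λ x → +-mono-≤ (fewer false x) (fewer true x)) at-w
    where
    new : Bool → VSet n
    new r x = label L r x ∨ (⌊ r Boolₚ.≟ p ⌋ ∧ ⌊ x ≟ w ⌋)
    fresh : ∀ {r x} → (⌊ r Boolₚ.≟ p ⌋ ∧ ⌊ x ≟ w ⌋) ≡ true → r ≡ p × x ≡ w
    fresh {r} {x} e with r Boolₚ.≟ p | x ≟ w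
    ... | yes r≡p | yes x≡w = r≡p , x≡w
    reached′ : ∀ {r x} → new r x ≡ true → ∃ (AltPath r x)
    reached′ {r} {x} e with label L r x in old
    ... | true = reached L old
    ... | false with fresh {r} {x} e
    ...   | refl , refl = path
    L′ : Labelling
    L′ = record { label = new ; reached = reached′ ; x0-labelled = cong (_∨ _) (x0-labelled L) }
    fewer : ∀ r x → 𝟙 (not (new r x)) ≤ 𝟙 (not (label L r x))
    fewer r x with label L r x
    ... | true = z≤n
    ... | false = 𝟙≤1 _
    newly : new p w ≡ true
    newly with p Boolₚ.≟ p | w ≟ w
    ... | yes _ | yes _ = Boolₚ.∨-zeroʳ (label L p w)
    ... | no p≢p | _ = ⊥-elim (p≢p refl)
    ... | _ | no w≢w = ⊥-elim (w≢w refl)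
    at-w : 𝟙 (not (new false w)) + 𝟙 (not (new true w))
         < 𝟙 (not (label L false w)) + 𝟙 (not (label L true w))
    at-w = sum-bool-< p (λ r → fewer r w)
                        (subst₂ (λ β γ → 𝟙 (not β) < 𝟙 (not γ)) (sym newly) (sym Lw) ≤-refl)

  search : (∀ S → ℤ.+ 0 ℤ.≤ delta a b K S) → (L : Labelling) → Acc _<_ (unlabelled L) → ∃ Improved
  search condition L (acc more) with frontier? L
  ... | no stuck = ⊥-elim (stuck-impossible condition L stuck)
  ... | yes (p , t , w , Lpt , e , Lw) = explore (proj₂ (reached L Lpt))
    where
    relabel : ∀ {vs′} → AltPath (not p) w vs′ → ∃ Improved
    relabel g′ with add-label L (not p) w Lw (_ , g′)
    ... | L′ , fewer = search condition L′ (more fewer)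
    explore : ∀ {vs} → AltPath p t vs → ∃ Improved
    explore {vs} g with w ∈? vs
    ... | yes w∈vs with prefix g w∈vs
    ...   | q , _ , g′ with q Boolₚ.≟ p
    ...     | yes refl = _ , augment-revisit g w∈vs e g′
    ...     | no q≢p = relabel (subst (λ r → AltPath r w _) (Boolₚ.¬-not q≢p) g′)
    explore {vs} g | no w∉vs with tight? (not p) w
    ...   | yes w-tight = relabel (extend g w∉vs e w-tight)
    ...   | no w-loose = _ , augment-fresh g w∉vs e w-loose

  initial : Labelling
  initial = record { label = start-label ; reached = start-reached ; x0-labelled = x0-start }
    where
    start-label : Bool → VSet n
    start-label false x = ⌊ x ≟ x0 ⌋
    start-label true _ = false
    start-reached : ∀ {p w} → start-label p w ≡ true → ∃ (AltPath p w)
    start-reached {false} {w} e with w ≟ x0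
    ... | yes refl = _ , start
    x0-start : start-label false x0 ≡ true
    x0-start with x0 ≟ x0
    ... | yes _ = refl
    ... | no x0≢x0 = ⊥-elim (x0≢x0 refl)

  improve : (∀ S → ℤ.+ 0 ℤ.≤ delta a b K S) → ∃ Improved
  improve condition = search condition initial (<-wellFounded (unlabelled initial))

lovasz-sufficient : ∀ {n a b} {K : BRel n} → a < b → IsSimple K →
  (∀ S → ℤ.+ 0 ℤ.≤ delta a b K S) → HasFactor a b K
lovasz-sufficient {n} {a} {b} {K} a<b K-simple condition =
  grow empty empty-bounded (<-wellFounded (deficiency a empty))
  where
  empty : BRel n
  empty _ _ = false
  empty-bounded : IsBoundedSubgraph a b K empty
  empty-bounded = (((λ _ _ → refl) , (λ _ → refl)) , λ _ _ ()) ,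
                  λ x → ≤-trans (≤-reflexive (trans (countV≡∑ (empty x)) (sum-replicate-zero n))) z≤n
  grow : ∀ H → IsBoundedSubgraph a b K H → Acc _<_ (deficiency a H) → HasFactor a b K
  grow H (H-sub , H≤b) (acc more) with Finₚ.any? (λ x → deg H x <? a)
  ... | no none-deficient = H , H-sub , λ x → ≮⇒≥ (λ dx<a → none-deficient (x , dx<a)) , H≤b x
  ... | yes (x0 , x0-deficient)
    with Augmentation.improve a<b K-simple (H-sub , H≤b) x0 x0-deficient condition
  ...   | A , A-bounded , fewer = grow A A-bounded (more fewer)

lemma6 : (n a b : ℕ) → 1 ≤ a → a < b →
    (G : BRel n) → IsSimple G →
    (u v : Fin n) → G u v ≡ true →
    (HasFactor a b (deleteEdge G u v) →
      ((S : VSet n) → ℤ.+ rho a G u v S ℤ.≤ delta a b G S))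
    × (((S : VSet n) → ℤ.+ rho a G u v S ℤ.≤ delta a b G S) →
      HasFactor a b (deleteEdge G u v))
lemma6 n a b 1≤a a<b G G-simple u v Guv = necessity , sufficiency
  where
  shift : ∀ S → delta a b (deleteEdge G u v) S ≡ delta a b G S ℤ.- ℤ.+ rho a G u v S
  shift = delta-deleteEdge a b 1≤a G-simple Guv
  necessity : HasFactor a b (deleteEdge G u v) → ∀ S → ℤ.+ rho a G u v S ℤ.≤ delta a b G S
  necessity factor S = ℤₚ.0≤i-j⇒j≤i (subst (ℤ.+ 0 ℤ.≤_) (shift S) (lovasz-necessary factor S))
  sufficiency : (∀ S → ℤ.+ rho a G u v S ℤ.≤ delta a b G S) → HasFactor a b (deleteEdge G u v)
  sufficiency ρ≤δ = lovasz-sufficient a<b (deleteEdge-IsSimple G-simple u v)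
    (λ S → subst (ℤ.+ 0 ℤ.≤_) (sym (shift S)) (ℤₚ.i≤j⇒0≤j-i (ρ≤δ S)))
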